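{- Let $b\geq2$ be fixed. For all sufficiently large $N$, $$\frac{N^2}{16b^2}\leq\mathcal{S}_{1,2}(N)\leq\frac{N^2}{2}\qquad\text{and}\qquad\frac{N^2}{8b}\leq\mathcal{S}_{2,1}(N)\leq\frac{N^2}{2}.$$ In particular $\mathcal{S}_{1,2}(N),\mathcal{S}_{2,1}(N)\asymp_b N^2$.
   Context: For a positive integer $n$ with exactly $L$ base-$b$ digits, $n=\sum_{0\leq i<L}\varepsilon_i(n)b^i$ ($\varepsilon_{L-1}(n)\ne0$), its digital reverse is $\overleftarrow{n}=\sum_{0\leq i<L}\varepsilon_i(n)b^{L-1-i}$. $\mathcal{S}_{1,2}(N)=\#\{(n_1,n_2,n_3)\in\mathbb{N}^3:n_1+n_2+n_3=N,\ (\overleftarrow{n_2}\,\overleftarrow{n_3},b)=1\}$ and $\mathcal{S}_{2,1}(N)=\#\{(n_1,n_2,n_3)\in\mathbb{N}^3:n_1+n_2+n_3=N,\ (\overleftarrow{n_3},b)=1\}$, where $(\cdot,\cdot)$ denotes gcd. -}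

module Defs where

open import Data.Nat using (ℕ; zero; suc; _+_; _*_; _∸_)
open import Data.Nat.DivMod using (_/_; _%_)
open import Data.Nat.GCD using (gcd)
open import Data.List using (List; []; _∷_; foldl; length; filter; upTo; map; concatMap)
open import Data.Product using (_×_; _,_)
open import Relation.Nullary using (Dec)
open import Relation.Binary.PropositionalEquality using (_≡_)
import Data.Nat as ℕ
open import Relation.Nullary.Decidable using (_×-dec_)

-- Base-b digits of n, least significant first: digitsAux b fuel n.
-- (For b ≥ 2 and n ≥ 1, fuel = n is more than enough.)
digitsAux : ℕ → ℕ → ℕ → List ℕ
digitsAux b zero n = []
digitsAux b (suc f) zero = []
digitsAux zero (suc f) (suc m) = []
digitsAux (suc c) (suc f) (suc m) =
  (suc m % suc c) ∷ digitsAux (suc c) f (suc m / suc c)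

digits : ℕ → ℕ → List ℕ
digits b n = digitsAux b n n

-- Digital reverse: for n = Σ_{i<L} ε_i b^i (ε_{L-1} ≠ 0),
-- rev b n = Σ_{i<L} ε_i b^{L-1-i}  (Horner evaluation of the reversed digit string).
rev : ℕ → ℕ → ℕ
rev b n = foldl (λ acc d → acc * b + d) 0 (digits b n)

pos : ℕ → List ℕ
pos N = map suc (upTo N)

triples : ℕ → List (ℕ × ℕ × ℕ)
triples N = concatMap (λ a → concatMap (λ c → map (λ d → (a , c , d)) (pos N)) (pos N)) (pos N)

cond12 : ℕ → ℕ → (t : ℕ × ℕ × ℕ) → Set
cond12 b N (a , c , d) = (a + c + d ≡ N) × (gcd (rev b c * rev b d) b ≡ 1)

cond12? : ∀ b N t → Dec (cond12 b N t)
cond12? b N (a , c , d) = (a + c + d ℕ.≟ N) ×-dec (gcd (rev b c * rev b d) b ℕ.≟ 1)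

cond21 : ℕ → ℕ → (t : ℕ × ℕ × ℕ) → Set
cond21 b N (a , c , d) = (a + c + d ≡ N) × (gcd (rev b d) b ≡ 1)

cond21? : ∀ b N t → Dec (cond21 b N t)
cond21? b N (a , c , d) = (a + c + d ℕ.≟ N) ×-dec (gcd (rev b d) b ℕ.≟ 1)

S12 : ℕ → ℕ → ℕ
S12 b N = length (filter (cond12? b N) (triples N))

S21 : ℕ → ℕ → ℕ
S21 b N = length (filter (cond21? b N) (triples N))

-- A number n with leading base-b digit 1, i.e. b ^ k ≤ n < 2 b ^ k, has a reverse whose last
-- digit is 1, so rev n ≡ 1 (mod b) is coprime to b. Fix the power B = b ^ k with 4B ≤ N < 4bB.
-- Every choice n₂, n₃ ∈ [B, 2B), n₁ = N − n₂ − n₃ is counted by S₁,₂, so S₁,₂ ≥ B² ≥ N²/(16b²);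
-- every choice n₁ ≤ N − 2B, n₃ ∈ [B, 2B), n₂ = N − n₁ − n₃ is counted by S₂,₁, so
-- S₂,₁ ≥ (N − 2B)B ≥ N²/(8b). Conversely n₁ leaves at most N − n₁ choices of n₂, which then
-- determine n₃, so both counts are at most Σ (N − n₁) ≤ N²/2.
module Submission where

open import Defs
open import Data.Nat using (ℕ; _*_; _≤_)
open import Data.Product using (_×_; ∃-syntax)
open import Level using (Level)
open import Data.Nat using (zero; suc; _+_; _∸_; _^_; _<_; _<?_; z≤n; s≤s; z<s; pred; NonZero; >-nonZero⁻¹; 2+)
open import Data.Nat.Properties
open import Data.Nat.DivMod using (_/_; _%_; [m+kn]%n≡m%n; %-distribˡ-*; m*n/n≡m; /-monoˡ-≤; m<n*o⇒m/o<n; m/n<m)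
open import Data.Nat.Divisibility using (_∣_; ∣1⇒≡1; %-presˡ-∣)
open import Data.Nat.GCD using (gcd; gcd[m,n]∣m; gcd[m,n]∣n)
open import Data.Nat.ListAction using (sum)
open import Data.Nat.ListAction.Properties using (sum-++)
open import Data.Nat.Tactic.RingSolver using (solve-∀)
open import Data.List using (List; []; _∷_; _++_; map; filter; length; concatMap; applyUpTo; foldl)
open import Data.List.Properties using (map-++; map-∘; map-cong; map-upTo)
open import Data.List.Membership.Propositional using (_∈_)
open import Data.List.Membership.Propositional.Properties using (∈-map⁺; ∈-upTo⁺)
open import Data.List.Relation.Unary.Any using (here; there)
open import Data.Product using (_,_; proj₁; proj₂)
open import Data.Sum using (inj₁; inj₂)
open import Function using (_∘_)
open import Relation.Nullary using (Dec; yes; no; contradiction)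
open import Relation.Unary using (Pred; Decidable)
open import Relation.Binary.PropositionalEquality using (_≡_; refl; sym; trans; cong; cong₂; subst; module ≡-Reasoning)
open import Algebra.Properties.CommutativeSemigroup +-commutativeSemigroup using (interchange)

private
  variable
    ℓ ℓ′ ℓ″ : Level
    X : Set ℓ′
    Y : Set ℓ″

∑ : List X → (X → ℕ) → ℕ
∑ xs f = sum (map f xs)

syntax ∑ xs (λ x → e) = ∑[ x ← xs ] e

∑-++ : ∀ xs ys (f : X → ℕ) → ∑ (xs ++ ys) f ≡ ∑ xs f + ∑ ys f
∑-++ xs ys f = trans (cong sum (map-++ f xs ys)) (sum-++ (map f xs) (map f ys))

∑-map : ∀ (g : X → Y) xs (f : Y → ℕ) → ∑ (map g xs) f ≡ ∑[ x ← xs ] f (g x)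
∑-map g xs f = cong sum (sym (map-∘ xs))

∑-concatMap : ∀ (g : X → List Y) xs (f : Y → ℕ) → ∑ (concatMap g xs) f ≡ ∑[ x ← xs ] ∑ (g x) f
∑-concatMap g []       f = refl
∑-concatMap g (x ∷ xs) f =
  trans (∑-++ (g x) (concatMap g xs) f) (cong (∑ (g x) f +_) (∑-concatMap g xs f))

∑-cong : ∀ xs {f g : X → ℕ} → (∀ x → f x ≡ g x) → ∑ xs f ≡ ∑ xs g
∑-cong xs f≗g = cong sum (map-cong f≗g xs)

∑-zero : ∀ (xs : List X) → ∑[ x ← xs ] 0 ≡ 0
∑-zero []       = refl
∑-zero (x ∷ xs) = ∑-zero xs

∑-+ : ∀ xs (f g : X → ℕ) → ∑[ x ← xs ] (f x + g x) ≡ ∑ xs f + ∑ xs g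
∑-+ []       f g = refl
∑-+ (x ∷ xs) f g =
  trans (cong (f x + g x +_) (∑-+ xs f g)) (interchange (f x) (g x) (∑ xs f) (∑ xs g))

∑-comm : ∀ xs ys (h : X → Y → ℕ) → ∑[ x ← xs ] ∑[ y ← ys ] h x y ≡ ∑[ y ← ys ] ∑[ x ← xs ] h x y
∑-comm []       ys h = sym (∑-zero ys)
∑-comm (x ∷ xs) ys h =
  trans (cong (∑ ys (h x) +_) (∑-comm xs ys h)) (sym (∑-+ ys (h x) (λ y → ∑[ x ← xs ] h x y)))

∑-∈ : ∀ (f : X → ℕ) {x xs} → x ∈ xs → f x ≤ ∑ xs f
∑-∈ f (here refl)   = m≤m+n _ _
∑-∈ f (there x∈xs) = ≤-trans (∑-∈ f x∈xs) (m≤n+m _ _)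

∑-positive : ∀ xs {f : X → ℕ} → 0 < ∑ xs f → ∃[ x ] 0 < f x
∑-positive (x ∷ xs) {f} 0<∑ with 0 <? f x
... | yes 0<fx = x , 0<fx
... | no  0≮fx = ∑-positive xs (≤-trans 0<∑ (+-monoˡ-≤ (∑ xs f) (≮⇒≥ 0≮fx)))

𝟙 : {P : Set ℓ} → Dec P → ℕ
𝟙 (yes _) = 1
𝟙 (no  _) = 0

𝟙≤1 : {P : Set ℓ} (P? : Dec P) → 𝟙 P? ≤ 1
𝟙≤1 (yes _) = ≤-refl
𝟙≤1 (no  _) = z≤n

𝟙-sound : {P : Set ℓ} (P? : Dec P) → 0 < 𝟙 P? → P
𝟙-sound (yes p) _ = p

𝟙-complete : {P : Set ℓ} (P? : Dec P) → P → 0 < 𝟙 P?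
𝟙-complete (yes _) _ = ≤-refl
𝟙-complete (no ¬p) p = contradiction p ¬p

length-filter≡∑𝟙 : {P : Pred X ℓ} (P? : Decidable P) (xs : List X) →
                   length (filter P? xs) ≡ ∑[ x ← xs ] 𝟙 (P? x)
length-filter≡∑𝟙 P? []       = refl
length-filter≡∑𝟙 P? (x ∷ xs) with P? x
... | yes _ = cong suc (length-filter≡∑𝟙 P? xs)
... | no  _ = length-filter≡∑𝟙 P? xs

∑-pos-suc : ∀ N (g : ℕ → ℕ) → ∑ (pos (suc N)) g ≡ g 1 + ∑[ x ← pos N ] g (suc x)
∑-pos-suc N g = cong (g 1 +_) (begin
  ∑ (map suc (applyUpTo suc N)) g  ≡⟨ ∑-map suc (applyUpTo suc N) g ⟩
  ∑ (applyUpTo suc N) (g ∘ suc)    ≡⟨ cong (λ xs → ∑ xs (g ∘ suc)) (map-upTo suc N) ⟨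
  ∑ (pos N) (g ∘ suc)              ∎)
  where open ≡-Reasoning

term≤∑-pos : ∀ {N z} (g : ℕ → ℕ) → 0 < z → z ≤ N → g z ≤ ∑[ x ← pos N ] g x
term≤∑-pos {z = suc i} g _ i<N = ∑-∈ g (∈-map⁺ suc (∈-upTo⁺ i<N))

∑-pos-≥ : ∀ N {g : ℕ → ℕ} lo K {w} → lo + K ≤ N →
          (∀ x → lo < x → x ≤ lo + K → w ≤ g x) → K * w ≤ ∑[ x ← pos N ] g x
∑-pos-≥ N       lo       zero    _ _ = z≤n
∑-pos-≥ zero    zero     (suc K) () _
∑-pos-≥ zero    (suc lo) (suc K) () _
∑-pos-≥ (suc N) {g} zero (suc K) (s≤s K≤N) w≤g =
  ≤-trans (+-mono-≤ (w≤g 1 z<s (s≤s z≤n)) (∑-pos-≥ N 0 K K≤N λ x _ x≤K → w≤g (suc x) z<s (s≤s x≤K)))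
          (≤-reflexive (sym (∑-pos-suc N g)))
∑-pos-≥ (suc N) {g} (suc lo) (suc K) (s≤s lo+K≤N) w≤g =
  ≤-trans (∑-pos-≥ N lo (suc K) lo+K≤N λ x lo<x x≤ → w≤g (suc x) (s≤s lo<x) (s≤s x≤))
          (≤-trans (m≤n+m _ (g 1)) (≤-reflexive (sym (∑-pos-suc N g))))

∑-pos-≤ : ∀ N {g : ℕ → ℕ} lo K {w} → (∀ x → g x ≤ w) →
          (∀ x → 0 < x → 0 < g x → lo < x × x ≤ lo + K) → ∑[ x ← pos N ] g x ≤ K * w
∑-pos-≤ zero _ _ _ _ = z≤n
∑-pos-≤ (suc N) {g} zero zero g≤w supp =
  ≤-trans (≤-reflexive (∑-pos-suc N g))
          (+-mono-≤ (≮⇒≥ λ 0<g1 → contradiction (proj₂ (supp 1 z<s 0<g1)) λ ())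
                    (∑-pos-≤ N 0 0 (g≤w ∘ suc) λ x _ 0<g → contradiction (proj₂ (supp (suc x) z<s 0<g)) λ ()))
∑-pos-≤ (suc N) {g} zero (suc K) g≤w supp =
  ≤-trans (≤-reflexive (∑-pos-suc N g))
          (+-mono-≤ (g≤w 1) (∑-pos-≤ N 0 K (g≤w ∘ suc) λ x 0<x 0<g → 0<x , ≤-pred (proj₂ (supp (suc x) z<s 0<g))))
∑-pos-≤ (suc N) {g} (suc lo) K g≤w supp =
  ≤-trans (≤-reflexive (∑-pos-suc N g))
          (+-mono-≤ (≮⇒≥ λ 0<g1 → contradiction (proj₁ (supp 1 z<s 0<g1)) λ { (s≤s ()) })
                    (∑-pos-≤ N lo K (g≤w ∘ suc) λ x _ 0<g → shift (supp (suc x) z<s 0<g)))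
  where
  shift : ∀ {x} → suc lo < suc x × suc x ≤ suc lo + K → lo < x × x ≤ lo + K
  shift (lo<x , x≤) = ≤-pred lo<x , ≤-pred x≤

∑-pos-≤-point : ∀ N x₀ {g : ℕ → ℕ} {w} → (∀ x → g x ≤ w) → (∀ x → 0 < g x → x ≡ x₀) →
                ∑[ x ← pos N ] g x ≤ w
∑-pos-≤-point N x₀ {g} {w} g≤w supp =
  subst (_ ≤_) (*-identityˡ w) (∑-pos-≤ N (pred x₀) 1 g≤w at-x₀)
  where
  at-x₀ : ∀ x → 0 < x → 0 < g x → pred x₀ < x × x ≤ pred x₀ + 1
  at-x₀ (suc x) _ 0<g with refl ← supp (suc x) 0<g = ≤-refl , ≤-reflexive (+-comm 1 x)

1+2n+n²≡[1+n]² : ∀ n → suc (2 * n + n * n) ≡ suc n * suc n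
1+2n+n²≡[1+n]² = solve-∀

∑-pos-triangle : ∀ N {g : ℕ → ℕ} → (∀ x → g x ≤ N ∸ x) → 2 * ∑[ x ← pos N ] g x ≤ N * N
∑-pos-triangle zero    g≤ = z≤n
∑-pos-triangle (suc N) {g} g≤ = begin
  2 * ∑[ x ← pos (suc N) ] g x            ≡⟨ cong (2 *_) (∑-pos-suc N g) ⟩
  2 * (g 1 + ∑[ x ← pos N ] g (suc x))    ≡⟨ *-distribˡ-+ 2 (g 1) _ ⟩
  2 * g 1 + 2 * ∑[ x ← pos N ] g (suc x)  ≤⟨ +-mono-≤ (*-monoʳ-≤ 2 (g≤ 1)) (∑-pos-triangle N (g≤ ∘ suc)) ⟩
  2 * N + N * N                           ≤⟨ n≤1+n _ ⟩
  suc (2 * N + N * N)                     ≡⟨ 1+2n+n²≡[1+n]² N ⟩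
  suc N * suc N                           ∎
  where open ≤-Reasoning

rectangle≤∑³ : ∀ N {h : ℕ → ℕ → ℕ → ℕ} lo₁ K₁ lo₂ K₂ → (lo₁ + K₁) + (lo₂ + K₂) < N →
               (∀ x y → lo₁ < x → x ≤ lo₁ + K₁ → lo₂ < y → y ≤ lo₂ + K₂ → x + y < N →
                  0 < h x y (N ∸ (x + y))) →
               K₁ * K₂ ≤ ∑[ x ← pos N ] ∑[ y ← pos N ] ∑[ z ← pos N ] h x y z
rectangle≤∑³ N {h} lo₁ K₁ lo₂ K₂ corner<N 0<h =
  ∑-pos-≥ N lo₁ K₁ (≤-trans (m≤m+n (lo₁ + K₁) (lo₂ + K₂)) (<⇒≤ corner<N)) row
  where
  fibre : ∀ x → lo₁ < x → x ≤ lo₁ + K₁ → ∀ y → lo₂ < y → y ≤ lo₂ + K₂ → 1 ≤ ∑[ z ← pos N ] h x y z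
  fibre x lo₁<x x≤ y lo₂<y y≤ =
    ≤-trans (0<h x y lo₁<x x≤ lo₂<y y≤ x+y<N) (term≤∑-pos (h x y) (m<n⇒0<n∸m x+y<N) (m∸n≤m N (x + y)))
    where
    x+y<N : x + y < N
    x+y<N = ≤-<-trans (+-mono-≤ x≤ y≤) corner<N

  row : ∀ x → lo₁ < x → x ≤ lo₁ + K₁ → K₂ ≤ ∑[ y ← pos N ] ∑[ z ← pos N ] h x y z
  row x lo₁<x x≤ = subst (_≤ _) (*-identityʳ K₂)
    (∑-pos-≥ N lo₂ K₂ (≤-trans (m≤n+m (lo₂ + K₂) (lo₁ + K₁)) (<⇒≤ corner<N)) (fibre x lo₁<x x≤))

m+n+o≡p⇒o≡p∸[m+n] : ∀ m n {o p} → m + n + o ≡ p → o ≡ p ∸ (m + n)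
m+n+o≡p⇒o≡p∸[m+n] m n {o} refl = sym (m+n∸m≡n (m + n) o)

m+n+o≡p⇒n≤p∸m : ∀ m {n o p} → m + n + o ≡ p → n ≤ p ∸ m
m+n+o≡p⇒n≤p∸m m {n} {o} refl =
  subst (n ≤_) (sym (trans (cong (_∸ m) (+-assoc m n o)) (m+n∸m≡n m (n + o)))) (m≤m+n n o)

[p∸[m+n]]+m+n≡p : ∀ m n {p} → m + n ≤ p → p ∸ (m + n) + m + n ≡ p
[p∸[m+n]]+m+n≡p m n {p} m+n≤p = trans (+-assoc (p ∸ (m + n)) m n) (m∸n+n≡m m+n≤p)

m+[p∸[m+n]]+n≡p : ∀ m n {p} → m + n ≤ p → m + (p ∸ (m + n)) + n ≡ p
m+[p∸[m+n]]+n≡p m n {p} m+n≤p =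
  trans (cong (_+ n) (+-comm m (p ∸ (m + n)))) ([p∸[m+n]]+m+n≡p m n m+n≤p)

module _ (N : ℕ) {Q : Pred (ℕ × ℕ × ℕ) ℓ} (Q? : Decidable Q) where

  count≡∑³ : length (filter Q? (triples N)) ≡ ∑[ a ← pos N ] ∑[ c ← pos N ] ∑[ d ← pos N ] 𝟙 (Q? (a , c , d))
  count≡∑³ =
    trans (length-filter≡∑𝟙 Q? (triples N))
    (trans (∑-concatMap _ (pos N) _)
           (∑-cong (pos N) λ a → trans (∑-concatMap _ (pos N) _)
                                       (∑-cong (pos N) λ c → ∑-map _ (pos N) _)))

  count≤half-square : (∀ {a c d} → Q (a , c , d) → a + c + d ≡ N) →
                      2 * length (filter Q? (triples N)) ≤ N * N
  count≤half-square sum≡N =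
    subst (λ s → 2 * s ≤ N * N) (sym count≡∑³) (∑-pos-triangle N pairs≤)
    where
    fibre≤1 : ∀ a c → ∑[ d ← pos N ] 𝟙 (Q? (a , c , d)) ≤ 1
    fibre≤1 a c = ∑-pos-≤-point N (N ∸ (a + c)) (λ d → 𝟙≤1 (Q? (a , c , d)))
                    λ d 0<𝟙 → m+n+o≡p⇒o≡p∸[m+n] a c (sum≡N (𝟙-sound (Q? (a , c , d)) 0<𝟙))

    pairs≤ : ∀ a → ∑[ c ← pos N ] ∑[ d ← pos N ] 𝟙 (Q? (a , c , d)) ≤ N ∸ a
    pairs≤ a = subst (∑[ c ← pos N ] ∑[ d ← pos N ] 𝟙 (Q? (a , c , d)) ≤_) (*-identityʳ (N ∸ a))
                     (∑-pos-≤ N 0 (N ∸ a) (fibre≤1 a) support)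
      where
      support : ∀ c → 0 < c → 0 < ∑[ d ← pos N ] 𝟙 (Q? (a , c , d)) → 0 < c × c ≤ N ∸ a
      support c 0<c 0<∑ with d , 0<𝟙 ← ∑-positive (pos N) 0<∑ =
        0<c , m+n+o≡p⇒n≤p∸m a (sum≡N (𝟙-sound (Q? (a , c , d)) 0<𝟙))

%≡1⇒gcd≡1 : ∀ {m n} .{{_ : NonZero n}} → m % n ≡ 1 → gcd m n ≡ 1
%≡1⇒gcd≡1 {m} {n} m%n≡1 =
  ∣1⇒≡1 (subst (gcd m n ∣_) m%n≡1 (%-presˡ-∣ (gcd[m,n]∣m m n) (gcd[m,n]∣n m n)))

S-bounds : ℕ → ℕ → Set
S-bounds b N = ((N * N ≤ 16 * (b * b) * S12 b N) × (2 * S12 b N ≤ N * N))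
             × ((N * N ≤ 8 * b * S21 b N) × (2 * S21 b N ≤ N * N))

-- Writing the base as 2 + b-2 lets digitsAux b and 1 % b compute.
module Base (b-2 : ℕ) where

  b : ℕ
  b = 2 + b-2

  1<b : 1 < b
  1<b = s≤s (s≤s z≤n)

  acc*b+1%b≡1 : ∀ acc → (acc * b + 1) % b ≡ 1
  acc*b+1%b≡1 acc = trans (cong (_% b) (+-comm (acc * b) 1)) ([m+kn]%n≡m%n 1 acc b)

  horner-digits%b≡1 : ∀ k f {n} acc → b ^ k ≤ n → n < 2 * b ^ k → n ≤ f →
                      foldl (λ acc d → acc * b + d) acc (digitsAux b f n) % b ≡ 1
  horner-digits%b≡1 zero (suc zero)    {1} acc _ _ _ = acc*b+1%b≡1 acc
  horner-digits%b≡1 zero (suc (suc f)) {1} acc _ _ _ = acc*b+1%b≡1 acc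
  horner-digits%b≡1 zero f {suc (suc n)} acc _ (s≤s (s≤s ())) _
  horner-digits%b≡1 (suc k) f {zero} acc b^k≤0 _ _ = contradiction (≤-trans (m^n>0 b (suc k)) b^k≤0) n≮0
  horner-digits%b≡1 (suc k) (suc f) {suc m} acc lo hi (s≤s m≤f) =
    horner-digits%b≡1 k f (acc * b + suc m % b) lo′ hi′ (≤-pred (≤-trans (m/n<m (suc m) b 1<b) (s≤s m≤f)))
    where
    lo′ : b ^ k ≤ suc m / b
    lo′ = ≤-trans (≤-reflexive (sym (m*n/n≡m (b ^ k) b)))
                  (/-monoˡ-≤ b (≤-trans (≤-reflexive (*-comm (b ^ k) b)) lo))
    hi′ : suc m / b < 2 * b ^ k
    hi′ = m<n*o⇒m/o<n (≤-trans hi (≤-reflexive (regroup b (b ^ k))))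
      where
      regroup : ∀ x y → 2 * (x * y) ≡ 2 * y * x
      regroup = solve-∀

  Rev≡1On : ℕ → Set
  Rev≡1On B = ∀ {n} → B ≤ n → n < 2 * B → rev b n % b ≡ 1

  rev%b≡1 : ∀ k → Rev≡1On (b ^ k)
  rev%b≡1 k lo hi = horner-digits%b≡1 k _ 0 lo hi ≤-refl

  rev%b≡1-window : ∀ {B′} → Rev≡1On (suc B′) → ∀ {n} → B′ < n → n ≤ B′ + suc B′ → rev b n % b ≡ 1
  rev%b≡1-window {B′} rev≡1 B′<n n≤ = rev≡1 B′<n (≤-trans (s≤s n≤) (≤-reflexive (double B′)))
    where
    double : ∀ x → suc (x + suc x) ≡ 2 * suc x
    double = solve-∀

  *-%b≡1 : ∀ {m n} → m % b ≡ 1 → n % b ≡ 1 → (m * n) % b ≡ 1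
  *-%b≡1 {m} {n} m≡1 n≡1 = trans (%-distribˡ-* m n b) (cong₂ (λ x y → (x * y) % b) m≡1 n≡1)

  m*b^k<m*b^[1+k] : ∀ m .{{_ : NonZero m}} k → m * b ^ k < m * b ^ suc k
  m*b^k<m*b^[1+k] m k = *-monoʳ-< m (^-monoʳ-< b 1<b (n<1+n k))

  scale : ∀ {m} .{{_ : NonZero m}} N → m ≤ N → ∃[ k ] m * b ^ k ≤ N × N < m * b ^ suc k
  scale {m} zero m≤0 = contradiction (≤-trans (>-nonZero⁻¹ m) m≤0) n≮0
  scale {m} (suc N) m≤1+N with m≤n⇒m<n∨m≡n m≤1+N
  ... | inj₂ refl = 0 , ≤-reflexive (*-identityʳ m) , subst (_< m * b ^ 1) (*-identityʳ m) (m*b^k<m*b^[1+k] m 0)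
  ... | inj₁ m<1+N with scale N (≤-pred m<1+N)
  ...   | k , lo , hi with suc N <? m * b ^ suc k
  ...     | yes hi′ = k , m≤n⇒m≤1+n lo , hi′
  ...     | no  ≮hi = suc k , ≮⇒≥ ≮hi , ≤-<-trans hi (m*b^k<m*b^[1+k] m (suc k))

  S21-lower : ∀ B′ e → Rev≡1On (suc B′) → (2 * suc B′ + e) * suc B′ ≤ S21 b (4 * suc B′ + e)
  S21-lower B′ e rev≡1 = subst (_ ≤_) (sym reorder) (rectangle≤∑³ N 0 (2 * B + e) B′ B corner<N coprime)
    where
    B N : ℕ
    B = suc B′
    N = 4 * B + e

    reorder : S21 b N ≡ ∑[ a ← pos N ] ∑[ d ← pos N ] ∑[ c ← pos N ] 𝟙 (cond21? b N (a , c , d))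
    reorder = trans (count≡∑³ N (cond21? b N)) (∑-cong (pos N) λ a → ∑-comm (pos N) (pos N) _)

    corner : ∀ x e → suc ((0 + (2 * suc x + e)) + (x + suc x)) ≡ 4 * suc x + e
    corner = solve-∀

    corner<N : (0 + (2 * B + e)) + (B′ + B) < N
    corner<N = ≤-reflexive (corner B′ e)

    coprime : ∀ a d → 0 < a → a ≤ 0 + (2 * B + e) → B′ < d → d ≤ B′ + B → a + d < N →
              0 < 𝟙 (cond21? b N (a , N ∸ (a + d) , d))
    coprime a d _ _ B′<d d≤ a+d<N = 𝟙-complete (cond21? b N (a , N ∸ (a + d) , d))
      (m+[p∸[m+n]]+n≡p a d (<⇒≤ a+d<N) , %≡1⇒gcd≡1 {rev b d} (rev%b≡1-window rev≡1 B′<d d≤))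

  S12-lower : ∀ B′ e → Rev≡1On (suc B′) → suc B′ * suc B′ ≤ S12 b (4 * suc B′ + e)
  S12-lower B′ e rev≡1 = subst (_ ≤_) (sym reorder) (rectangle≤∑³ N B′ B B′ B corner<N coprime)
    where
    B N : ℕ
    B = suc B′
    N = 4 * B + e

    reorder : S12 b N ≡ ∑[ c ← pos N ] ∑[ d ← pos N ] ∑[ a ← pos N ] 𝟙 (cond12? b N (a , c , d))
    reorder = trans (count≡∑³ N (cond12? b N))
                    (trans (∑-comm (pos N) (pos N) _) (∑-cong (pos N) λ c → ∑-comm (pos N) (pos N) _))

    corner : ∀ x e → suc (suc ((x + suc x) + (x + suc x))) + e ≡ 4 * suc x + e
    corner = solve-∀

    corner<N : (B′ + B) + (B′ + B) < N
    corner<N = ≤-trans (≤-trans (n≤1+n _) (m≤m+n _ e)) (≤-reflexive (corner B′ e))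

    coprime : ∀ c d → B′ < c → c ≤ B′ + B → B′ < d → d ≤ B′ + B → c + d < N →
              0 < 𝟙 (cond12? b N (N ∸ (c + d) , c , d))
    coprime c d B′<c c≤ B′<d d≤ c+d<N = 𝟙-complete (cond12? b N (N ∸ (c + d) , c , d))
      ( [p∸[m+n]]+m+n≡p c d (<⇒≤ c+d<N)
      , %≡1⇒gcd≡1 {rev b c * rev b d}
          (*-%b≡1 {rev b c} {rev b d} (rev%b≡1-window rev≡1 B′<c c≤) (rev%b≡1-window rev≡1 B′<d d≤)))

  bounds-at-scale : ∀ {N} B .{{_ : NonZero B}} → Rev≡1On B → 4 * B ≤ N → N ≤ 4 * (b * B) → S-bounds b N
  bounds-at-scale (suc B′) rev≡1 4B≤N N≤ with e , refl ← m≤n⇒∃[o]m+o≡n 4B≤N =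
    (S12-bound , count≤half-square N (cond12? b N) proj₁) ,
    (S21-bound , count≤half-square N (cond21? b N) proj₁)
    where
    open ≤-Reasoning
    B N : ℕ
    B = suc B′
    N = 4 * B + e

    square : ∀ x y → 4 * (x * y) * (4 * (x * y)) ≡ 16 * (x * x) * (y * y)
    square = solve-∀

    S12-bound : N * N ≤ 16 * (b * b) * S12 b N
    S12-bound = begin
      N * N                           ≤⟨ *-mono-≤ N≤ N≤ ⟩
      4 * (b * B) * (4 * (b * B))     ≡⟨ square b B ⟩
      16 * (b * b) * (B * B)          ≤⟨ *-monoʳ-≤ (16 * (b * b)) (S12-lower B′ e rev≡1) ⟩
      16 * (b * b) * S12 b N          ∎

    regroup : ∀ x y e → 4 * (x * y) * (4 * y + e) + 4 * (x * y) * e ≡ 8 * x * ((2 * y + e) * y)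
    regroup = solve-∀

    S21-bound : N * N ≤ 8 * b * S21 b N
    S21-bound = begin
      N * N                                      ≤⟨ *-monoˡ-≤ N N≤ ⟩
      4 * (b * B) * N                            ≤⟨ m≤m+n _ (4 * (b * B) * e) ⟩
      4 * (b * B) * N + 4 * (b * B) * e          ≡⟨ regroup b B e ⟩
      8 * b * ((2 * B + e) * B)                  ≤⟨ *-monoʳ-≤ (8 * b) (S21-lower B′ e rev≡1) ⟩
      8 * b * S21 b N                            ∎

lemma4p1 : (b : ℕ) → 2 ≤ b →
    ∃[ N₀ ] ((N : ℕ) → N₀ ≤ N →
      ((N * N ≤ 16 * (b * b) * S12 b N) × (2 * S12 b N ≤ N * N))
      × ((N * N ≤ 8 * b * S21 b N) × (2 * S21 b N ≤ N * N)))
lemma4p1 (2+ b-2) (s≤s (s≤s z≤n)) = 4 , bounds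
  where
  open Base b-2
  bounds : ∀ N → 4 ≤ N → S-bounds b N
  bounds N 4≤N with k , lo , hi ← scale N 4≤N =
    bounds-at-scale (b ^ k) {{m^n≢0 b k}} (rev%b≡1 k) lo (<⇒≤ hi)
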